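{- Let $L = (a_0, a_1)$ be a \textsc{Rotisserie Nim} position with two heaps. Then $L \in \mathcal{N}$ if and only if $a_0 > a_1$.
   Context: \textsc{Rotisserie Nim} is an impartial combinatorial game played under normal play (a player unable to move loses). A position is a finite list $L = (a_0, a_1, \ldots, a_n)$ of positive integers (a queue of heaps, $a_0$ at the front); the empty list is terminal. The options of $L$ are $(a_1, \ldots, a_n)$ and $(a_1, \ldots, a_n, b)$ for every integer $b$ with $1 \leq b < a_0$ (sticks are removed from the front heap, and if any remain that heap is moved to the back). $\mathcal{N}$ denotes the positions from which the next player to move wins, $\mathcal{P}$ those from which the previous player wins. -}

module Defs where

open import Data.Nat using (ℕ; zero; suc; _<_; _≤_)
open import Data.List using (List; []; _∷_; _++_; [_])

-- A Rotisserie Nim position: a list of heap sizes, front first.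
-- (Heaps are required to be positive; this is imposed where positions are
-- quantified over.)
Position : Set
Position = List ℕ

data Move : Position → Position → Set where
  take-all : ∀ {a} {as} → Move (a ∷ as) as
  take-some : ∀ {a b} {as} → 1 ≤ b → b < a → Move (a ∷ as) (as ++ [ b ])

-- Normal play outcome classes, defined inductively
-- (the game is finite: every move decreases the total number of sticks).
data IsN : Position → Set
data IsP : Position → Set

data IsN where
  win : ∀ {L L'} → Move L L' → IsP L' → IsN L

data IsP where
  lose : ∀ {L} → (∀ {L'} → Move L L' → IsN L') → IsP L

-- Two heaps (a, b) with a ≤ b are a P-position: whatever the mover leaves of
-- the front heap, the reply trims b to the same size, so the mover again faces
-- two equal, smaller heaps; taking the front heap whole leaves a lone heap,
-- which the reply takes. For a > b the move to (b, b) therefore wins.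
module Submission where

open import Defs
open import Data.Nat using (ℕ; _≤_; _>_; _<_)
open import Data.Nat.Properties using (≤-refl; <-≤-trans; ≰⇒>)
open import Data.Nat.Induction using (<-wellFounded)
open import Data.List using (_∷_; [])
open import Data.Empty using (⊥)
open import Function.Bundles using (_⇔_; mk⇔)
open import Induction.WellFounded using (Acc; acc)

N⇒¬P : ∀ {L} → IsN L → IsP L → ⊥
N⇒¬P (win m p) (lose f) = N⇒¬P (f m) p

singleton-N : ∀ a → IsN (a ∷ [])
singleton-N a = win take-all (lose λ ())

≤⇒pair-P-acc : ∀ {a b} → Acc _<_ a → 1 ≤ b → a ≤ b → IsP (a ∷ b ∷ [])
≤⇒pair-P-acc {b = b} (acc rs) 1≤b a≤b = lose λ
  { take-all → singleton-N b
  ; (take-some 1≤c c<a) →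
      win (take-some 1≤c (<-≤-trans c<a a≤b)) (≤⇒pair-P-acc (rs c<a) 1≤c ≤-refl)
  }

≤⇒pair-P : ∀ {a b} → 1 ≤ b → a ≤ b → IsP (a ∷ b ∷ [])
≤⇒pair-P = ≤⇒pair-P-acc (<-wellFounded _)

>⇒pair-N : ∀ {a b} → 1 ≤ b → b < a → IsN (a ∷ b ∷ [])
>⇒pair-N 1≤b b<a = win (take-some 1≤b b<a) (≤⇒pair-P 1≤b ≤-refl)

mainTheorem5 : (a₀ a₁ : ℕ) → 1 ≤ a₀ → 1 ≤ a₁ →
    IsN (a₀ ∷ a₁ ∷ []) ⇔ (a₀ > a₁)
mainTheorem5 a₀ a₁ _ 1≤a₁ = mk⇔ N⇒> (>⇒pair-N 1≤a₁)
  where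
  N⇒> : IsN (a₀ ∷ a₁ ∷ []) → a₀ > a₁
  N⇒> n = ≰⇒> λ a₀≤a₁ → N⇒¬P n (≤⇒pair-P 1≤a₁ a₀≤a₁)
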